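{- Let $N\in\mathbb{N}$, $j\in\mathbb{N}_0$ and $m\in\{0,\dots,2^j-1\}$. Then $|\mu^{N,\mathrm{sym}}_{j,m}|\le\frac1{2^{j-1}}\frac1N$ if $j<\lceil\log_2N\rceil$, and $|\mu^{N,\mathrm{sym}}_{j,m}|=2^{ -2j-2}$ if $j\ge\lceil\log_2N\rceil$.
   Context: For $n\in\mathbb{N}_0$ with binary expansion $n=\sum_{i=0}^k n_i2^i$, $\varphi(n)=\sum_{i=0}^k n_i2^{ -i-1}$. The symmetrized van der Corput sequence $(z_n)_{n\ge0}$ is given by $z_{2m}=\varphi(m)$, $z_{2m+1}=1-\varphi(m)$. Its local discrepancy is $D^{\mathrm{sym}}_N(t)=\frac1N\sum_{n=0}^{N-1}\mathbf{1}_{[0,t)}(z_n)-t$. For $j\ge0$, $m\in\{0,\dots,2^j-1\}$, the Haar function $h_{j,m}$ on $[0,1)$ equals $+1$ on $[m2^{ -j},(2m+1)2^{ -j-1})$, $-1$ on $[(2m+1)2^{ -j-1},(m+1)2^{ -j})$, and $0$ elsewhere. Set $\mu^{N,\mathrm{sym}}_{j,m}=\int_0^1D^{\mathrm{sym}}_N(t)h_{j,m}(t)\,dt$. -}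

module Defs where

open import Data.Nat as ℕ using (ℕ; zero; suc; _%_; _∸_)
open import Data.Nat.DivMod using (_/_)
open import Data.Integer using (+_)
open import Data.Rational using (ℚ; 0ℚ; 1ℚ; ½; _+_; _*_; _-_; _⊔_) renaming (_/_ to _÷ℤ_)

ι : ℕ → ℚ
ι n = + n ÷ℤ 1

inv2^ : ℕ → ℚ
inv2^ zero    = 1ℚ
inv2^ (suc j) = ½ * inv2^ j

-- radical inverse φ(n) = Σ n_i 2^{-i-1}; the first argument is fuel
-- (n itself suffices, since n has at most n binary digits)
φaux : ℕ → ℕ → ℚ
φaux zero    n = 0ℚ
φaux (suc k) n = ½ * ι (n % 2) + ½ * φaux k (n / 2)

φ : ℕ → ℚ
φ n = φaux n n

z : ℕ → ℚ
z n with n % 2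
... | zero  = φ (n / 2)
... | suc _ = 1ℚ - φ (n / 2)

Σ< : ℕ → (ℕ → ℚ) → ℚ
Σ< zero    f = 0ℚ
Σ< (suc N) f = Σ< N f + f N

-- endpoints of the Haar support: a = m 2^{-j}, c = (2m+1) 2^{-j-1}, b = (m+1) 2^{-j}
haarA haarC haarB : ℕ → ℕ → ℚ
haarA j m = ι m * inv2^ j
haarC j m = ι (2 ℕ.* m ℕ.+ 1) * inv2^ (suc j)
haarB j m = ι (suc m) * inv2^ j

-- Lebesgue measure of [x,1) ∩ [u,v)  (for 0 ≤ u ≤ v ≤ 1)
segLen : ℚ → ℚ → ℚ → ℚ
segLen x u v = 0ℚ ⊔ (v - (x ⊔ u))

-- ∫_0^1 1_{[0,t)}(x) h_{j,m}(t) dt = ∫_x^1 h_{j,m}(t) dt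
--   = |[x,1) ∩ [a,c)| - |[x,1) ∩ [c,b)|
intIndHaar : ℕ → ℕ → ℚ → ℚ
intIndHaar j m x = segLen x (haarA j m) (haarC j m) - segLen x (haarC j m) (haarB j m)

-- ∫_0^1 t h_{j,m}(t) dt = ∫_a^c t dt - ∫_c^b t dt = (c²-a²)/2 - (b²-c²)/2
intIdHaar : ℕ → ℕ → ℚ
intIdHaar j m =
  ½ * (c * c - a * a) - ½ * (b * b - c * c)
  where
    a = haarA j m
    b = haarB j m
    c = haarC j m

-- μ^{N,sym}_{j,m} = ∫_0^1 D^sym_N(t) h_{j,m}(t) dt
--   = (1/N) Σ_{n<N} ∫_0^1 1_{[0,t)}(z_n) h_{j,m}(t) dt - ∫_0^1 t h_{j,m}(t) dt
μsym : (N : ℕ) → .{{_ : ℕ.NonZero N}} → ℕ → ℕ → ℚ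
μsym N j m = (+ 1 ÷ℤ N) * Σ< N (λ n → intIndHaar j m (z n)) - intIdHaar j m

{-# OPTIONS --safe #-}
-- Write g_{j,m}(x) = ∫ (1_{[0,t)}(x) - t) h_{j,m}(t) dt, so that μ^{N,sym}_{j,m} is the mean
-- of g_{j,m}(z_n) over n < N, and split the z_n into the values φ(k) and 1 - φ(k).  Both of
-- these sequences w are self-similar: w(2k) and w(2k+1) are w(k)/2 and w(k)/2 + 1/2 in some
-- order.  Dually, on one of the halves [0,1/2], [1/2,1] the function g_{j+1,m} is a halved
-- copy of some g_{j,m′} lowered by c = 2^{-2j-4}, and on the other half it is the constant c.
-- Hence the partial sums S_{j+1}(K) = Σ_{k<K} g_{j+1,m}(w k) satisfy S_{j+1}(2P) = S_j(P)/2
-- and S_{j+1}(2P+1) ∈ {S_j(P+1)/2 - c, S_j(P)/2 + c}, and induction on j gives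
-- |S_j(K)| ≤ 2^{-j-1} - 2^{-2j-2} for all K.  The same recursion for x ↦ ∫_x^1 h_{j,m}
-- (where c = 0) makes its sums vanish for K ≤ 2^j, so when N ≤ 2^j only the term
-- -∫ t h_{j,m}(t) dt = 2^{-2j-2} survives.
module Submission where

open import Defs
open import Data.Nat as ℕ using (ℕ; suc; _<_; _≥_; _^_; NonZero)
open import Data.Nat.Logarithm using (⌈log₂_⌉)
open import Data.Integer using (+_)
open import Data.Rational using (ℚ; ∣_∣; _≤_; _*_) renaming (_/_ to _÷ℤ_)
open import Data.Product using (_×_)
open import Relation.Binary.PropositionalEquality using (_≡_)

open import Data.Nat using (zero; z≤n; s≤s)
open import Data.Nat.Logarithm using (⌈log₂⌉-mono-≤; ⌈log₂⌈n/2⌉⌉≡⌈log₂n⌉∸1)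
import Data.Nat.Tactic.RingSolver as ℕ-Solver
import Data.Nat.Properties as ℕₚ
import Data.Nat.DivMod as ℕ
open import Data.Nat.Divisibility using (divides)
import Data.Nat.Coprimality as Coprime
import Data.Integer as ℤ
import Data.Integer.Properties as ℤₚ
open import Data.Rational using (mkℚ; 0ℚ; 1ℚ; ½; _+_; _-_; -_; _⊔_; *≤*)
import Data.Rational as ℚ using (nonNegative)
import Data.Rational.Properties as ℚₚ
open import Data.Product using (_,_; proj₁; proj₂; ∃-syntax; ∃₂)
open import Data.Sum using (_⊎_; inj₁; inj₂; [_,_]′)
open import Function using (_∘_)
open import Level using (0ℓ)
open import Relation.Nullary using (yes; no)
open import Relation.Nullary.Decidable using (dec⇒maybe)
open import Relation.Binary.PropositionalEquality
  using (refl; sym; trans; cong; cong₂; subst; subst₂; module ≡-Reasoning)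
open import Tactic.RingSolver using (solve-∀)
open import Tactic.RingSolver.Core.AlmostCommutativeRing
  using (AlmostCommutativeRing; fromCommutativeRing)

ℚ-ring : AlmostCommutativeRing 0ℓ 0ℓ
ℚ-ring = fromCommutativeRing ℚₚ.+-*-commutativeRing (λ x → dec⇒maybe (0ℚ ℚₚ.≟ x))

ι-mkℚ : ∀ n → ι n ≡ mkℚ (+ n) 0 (Coprime.sym (Coprime.1-coprimeTo n))
ι-mkℚ n = ℚₚ.normalize-coprime (Coprime.sym (Coprime.1-coprimeTo n))

ι-+ : ∀ a b → ι (a ℕ.+ b) ≡ ι a + ι b
ι-+ a b = trans (cong (_÷ℤ 1) (sym (cong₂ ℤ._+_ (ℤₚ.*-identityʳ (+ a)) (ℤₚ.*-identityʳ (+ b)))))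
                (sym (cong₂ _+_ (ι-mkℚ a) (ι-mkℚ b)))

ι-2* : ∀ n → ι (2 ℕ.* n) ≡ ι n + ι n
ι-2* n = trans (ι-+ n (n ℕ.+ 0)) (cong (λ k → ι n + ι k) (ℕₚ.+-identityʳ n))

ι-mono-≤ : ∀ {a b} → a ℕ.≤ b → ι a ≤ ι b
ι-mono-≤ {a} {b} a≤b = subst₂ _≤_ (sym (ι-mkℚ a)) (sym (ι-mkℚ b))
  (*≤* (subst₂ ℤ._≤_ (sym (ℤₚ.*-identityʳ (+ a))) (sym (ℤₚ.*-identityʳ (+ b))) (ℤ.+≤+ a≤b)))

ι-nonneg : ∀ n → 0ℚ ≤ ι n
ι-nonneg n = ι-mono-≤ {0} {n} z≤n

1/N*ιN≡1 : ∀ N .{{_ : NonZero N}} → (+ 1 ÷ℤ N) * ι N ≡ 1ℚ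
1/N*ιN≡1 (suc n) = trans (cong₂ _*_ (ℚₚ.normalize-coprime (Coprime.1-coprimeTo (suc n))) (ι-mkℚ (suc n)))
  (ℚₚ.*-inverseˡ (mkℚ (+ suc n) 0 (Coprime.sym (Coprime.1-coprimeTo (suc n)))))

inv2^-nonneg : ∀ j → 0ℚ ≤ inv2^ j
inv2^-nonneg zero    = ℚₚ.nonNegative⁻¹ 1ℚ
inv2^-nonneg (suc j) = ℚₚ.*-monoˡ-≤-nonNeg ½ (inv2^-nonneg j)

inv2^-+ : ∀ a b → inv2^ (a ℕ.+ b) ≡ inv2^ a * inv2^ b
inv2^-+ zero    b = sym (ℚₚ.*-identityˡ (inv2^ b))
inv2^-+ (suc a) b = trans (cong (½ *_) (inv2^-+ a b)) (sym (ℚₚ.*-assoc ½ (inv2^ a) (inv2^ b)))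

ι[2^j]*inv2^j≡1 : ∀ j → ι (2 ^ j) * inv2^ j ≡ 1ℚ
ι[2^j]*inv2^j≡1 zero    = refl
ι[2^j]*inv2^j≡1 (suc j) = begin
  ι (2 ℕ.* 2 ^ j) * (½ * inv2^ j)     ≡⟨ cong (_* (½ * inv2^ j)) (ι-2* (2 ^ j)) ⟩
  (ι (2 ^ j) + ι (2 ^ j)) * (½ * inv2^ j) ≡⟨ double-half (ι (2 ^ j)) (inv2^ j) ⟩
  ι (2 ^ j) * inv2^ j                 ≡⟨ ι[2^j]*inv2^j≡1 j ⟩
  1ℚ                                  ∎
  where
  open ≡-Reasoning
  double-half : ∀ p i → (p + p) * (½ * i) ≡ p * i
  double-half = solve-∀ ℚ-ring

p≤q⇒p-q≤0 : ∀ {p q} → p ≤ q → p - q ≤ 0ℚ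
p≤q⇒p-q≤0 {p} {q} p≤q = subst (p - q ≤_) (ℚₚ.+-inverseʳ q) (ℚₚ.+-monoˡ-≤ (- q) p≤q)

p≤q⇒0≤q-p : ∀ {p q} → p ≤ q → 0ℚ ≤ q - p
p≤q⇒0≤q-p {p} {q} p≤q = subst (_≤ q - p) (ℚₚ.+-inverseʳ p) (ℚₚ.+-monoˡ-≤ (- p) p≤q)

0≤q⇒p≤p+q : ∀ p {q} → 0ℚ ≤ q → p ≤ p + q
0≤q⇒p≤p+q p {q} 0≤q = subst (_≤ p + q) (ℚₚ.+-identityʳ p) (ℚₚ.+-monoʳ-≤ p 0≤q)

½*-mono-≤ : ∀ {p q} → p ≤ q → ½ * p ≤ ½ * q
½*-mono-≤ = ℚₚ.*-monoˡ-≤-nonNeg ½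

-q≤p≤q⇒∣p∣≤q : ∀ {p q} → - q ≤ p → p ≤ q → ∣ p ∣ ≤ q
-q≤p≤q⇒∣p∣≤q {p} {q} -q≤p p≤q with ℚₚ.∣p∣≡p∨∣p∣≡-p p
... | inj₁ ∣p∣≡p  = subst (_≤ q) (sym ∣p∣≡p) p≤q
... | inj₂ ∣p∣≡-p = subst₂ _≤_ (sym ∣p∣≡-p) (neg-involutive q) (ℚₚ.neg-antimono-≤ -q≤p)
  where
  neg-involutive : ∀ q → - - q ≡ q
  neg-involutive = solve-∀ ℚ-ring

∣±p∣≤q : ∀ {u p q} → u ≡ p ⊎ u ≡ - p → ∣ p ∣ ≤ q → ∣ u ∣ ≤ q
∣±p∣≤q {q = q} (inj₁ u≡p)  ∣p∣≤q = subst (λ t → ∣ t ∣ ≤ q) (sym u≡p) ∣p∣≤q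
∣±p∣≤q {p = p} {q} (inj₂ u≡-p) ∣p∣≤q =
  subst (λ t → ∣ t ∣ ≤ q) (sym u≡-p) (subst (_≤ q) (sym (ℚₚ.∣-p∣≡∣p∣ p)) ∣p∣≤q)

Σ<-cong : ∀ K {f g : ℕ → ℚ} → (∀ k → f k ≡ g k) → Σ< K f ≡ Σ< K g
Σ<-cong zero    f≗g = refl
Σ<-cong (suc K) f≗g = cong₂ _+_ (Σ<-cong K f≗g) (f≗g K)

Σ<-+ : ∀ K (f g : ℕ → ℚ) → Σ< K (λ k → f k + g k) ≡ Σ< K f + Σ< K g
Σ<-+ zero    f g = sym (ℚₚ.+-identityʳ 0ℚ)
Σ<-+ (suc K) f g = trans (cong (_+ (f K + g K)) (Σ<-+ K f g)) (interchange (Σ< K f) (Σ< K g) (f K) (g K))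
  where
  interchange : ∀ a b c d → (a + b) + (c + d) ≡ (a + c) + (b + d)
  interchange = solve-∀ ℚ-ring

Σ<-*ˡ : ∀ K c (f : ℕ → ℚ) → Σ< K (λ k → c * f k) ≡ c * Σ< K f
Σ<-*ˡ zero    c f = sym (ℚₚ.*-zeroʳ c)
Σ<-*ˡ (suc K) c f = trans (cong (_+ c * f K) (Σ<-*ˡ K c f)) (sym (ℚₚ.*-distribˡ-+ c (Σ< K f) (f K)))

Σ<-const : ∀ K c → Σ< K (λ _ → c) ≡ ι K * c
Σ<-const zero    c = sym (ℚₚ.*-zeroˡ c)
Σ<-const (suc K) c = begin
  Σ< K (λ _ → c) + c  ≡⟨ cong (_+ c) (Σ<-const K c) ⟩
  ι K * c + c         ≡⟨ step (ι K) c ⟩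
  (1ℚ + ι K) * c      ≡⟨ cong (_* c) (sym (ι-+ 1 K)) ⟩
  ι (suc K) * c       ∎
  where
  open ≡-Reasoning
  step : ∀ k c → k * c + c ≡ (1ℚ + k) * c
  step = solve-∀ ℚ-ring

Σ<-2* : ∀ K (f : ℕ → ℚ) → Σ< (2 ℕ.* K) f ≡ Σ< K (λ k → f (2 ℕ.* k) + f (suc (2 ℕ.* k)))
Σ<-2* zero    f = refl
Σ<-2* (suc K) f = begin
  Σ< (2 ℕ.* suc K) f                                  ≡⟨ cong (λ n → Σ< n f) (ℕₚ.*-suc 2 K) ⟩
  Σ< (2 ℕ.* K) f + f (2 ℕ.* K) + f (suc (2 ℕ.* K))    ≡⟨ ℚₚ.+-assoc (Σ< (2 ℕ.* K) f) _ _ ⟩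
  Σ< (2 ℕ.* K) f + (f (2 ℕ.* K) + f (suc (2 ℕ.* K)))
    ≡⟨ cong (_+ (f (2 ℕ.* K) + f (suc (2 ℕ.* K)))) (Σ<-2* K f) ⟩
  Σ< (suc K) (λ k → f (2 ℕ.* k) + f (suc (2 ℕ.* k)))  ∎
  where open ≡-Reasoning

data EvenOdd : ℕ → Set where
  even : ∀ k → EvenOdd (2 ℕ.* k)
  odd  : ∀ k → EvenOdd (suc (2 ℕ.* k))

evenOdd : ∀ n → EvenOdd n
evenOdd zero = even 0
evenOdd (suc n) with evenOdd n
... | even k = odd k
... | odd k  = subst EvenOdd (ℕₚ.*-suc 2 k) (even (suc k))

Σ<-evens-odds : ∀ N → ∃₂ λ K₁ K₂ → K₁ ℕ.+ K₂ ≡ N ×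
  ∀ f → Σ< N f ≡ Σ< K₁ (λ k → f (2 ℕ.* k)) + Σ< K₂ (λ k → f (suc (2 ℕ.* k)))
Σ<-evens-odds N with evenOdd N
... | even K = K , K , cong (K ℕ.+_) (sym (ℕₚ.+-identityʳ K)) ,
  λ f → trans (Σ<-2* K f) (Σ<-+ K _ _)
... | odd K  = suc K , K , cong (λ n → suc (K ℕ.+ n)) (sym (ℕₚ.+-identityʳ K)) ,
  λ f → trans (cong (_+ f (2 ℕ.* K)) (trans (Σ<-2* K f) (Σ<-+ K _ _)))
               (swap (Σ< K _) (Σ< K _) (f (2 ℕ.* K)))
  where
  swap : ∀ a b c → (a + b) + c ≡ (a + c) + b
  swap = solve-∀ ℚ-ring

record HalvingRecurrence (F G : ℕ → ℚ) (e : ℚ) : Set where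
  field
    at-even : ∀ P → F (2 ℕ.* P) ≡ ½ * G P
    at-odd  : ∀ P → F (suc (2 ℕ.* P)) ≡ ½ * G (suc P) - e ⊎ F (suc (2 ℕ.* P)) ≡ ½ * G P + e

open HalvingRecurrence

∣½p+q∣≤½r+∣q∣ : ∀ {p q r} → ∣ p ∣ ≤ r → ∣ ½ * p + q ∣ ≤ ½ * r + ∣ q ∣
∣½p+q∣≤½r+∣q∣ {p} {q} {r} ∣p∣≤r = begin
  ∣ ½ * p + q ∣       ≤⟨ ℚₚ.∣p+q∣≤∣p∣+∣q∣ (½ * p) q ⟩
  ∣ ½ * p ∣ + ∣ q ∣   ≡⟨ cong (_+ ∣ q ∣) (ℚₚ.∣p*q∣≡∣p∣*∣q∣ ½ p) ⟩
  ½ * ∣ p ∣ + ∣ q ∣   ≤⟨ ℚₚ.+-monoˡ-≤ ∣ q ∣ (½*-mono-≤ ∣p∣≤r) ⟩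
  ½ * r + ∣ q ∣       ∎
  where open ℚₚ.≤-Reasoning

HalvingRecurrence-∣∣≤ : ∀ {F G e B} → HalvingRecurrence F G e → (∀ K → ∣ G K ∣ ≤ B) →
                        ∀ K → ∣ F K ∣ ≤ ½ * B + ∣ e ∣
HalvingRecurrence-∣∣≤ {F} {G} {e} {B} H ∣G∣≤B K with evenOdd K
... | even P = begin
  ∣ F (2 ℕ.* P) ∣   ≡⟨ cong ∣_∣ (at-even H P) ⟩
  ∣ ½ * G P ∣       ≡⟨ ℚₚ.∣p*q∣≡∣p∣*∣q∣ ½ (G P) ⟩
  ½ * ∣ G P ∣       ≤⟨ ½*-mono-≤ (∣G∣≤B P) ⟩
  ½ * B             ≤⟨ 0≤q⇒p≤p+q (½ * B) (ℚₚ.0≤∣p∣ e) ⟩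
  ½ * B + ∣ e ∣     ∎
  where open ℚₚ.≤-Reasoning
... | odd P  =
  [ (λ F≡ → subst₂ (λ t b → ∣ t ∣ ≤ ½ * B + b) (sym F≡) (ℚₚ.∣-p∣≡∣p∣ e) (∣½p+q∣≤½r+∣q∣ (∣G∣≤B (suc P))))
  , (λ F≡ → subst (λ t → ∣ t ∣ ≤ ½ * B + ∣ e ∣) (sym F≡) (∣½p+q∣≤½r+∣q∣ (∣G∣≤B P)))
  ]′ (at-odd H P)

HalvingRecurrence-≡0 : ∀ {F G} → HalvingRecurrence F G 0ℚ → ∀ n →
                       (∀ K → K ℕ.≤ n → G K ≡ 0ℚ) → ∀ K → K ℕ.≤ 2 ℕ.* n → F K ≡ 0ℚ
HalvingRecurrence-≡0 H n G≡0 K K≤2n with evenOdd K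
... | even P = trans (at-even H P) (cong (½ *_) (G≡0 P (ℕₚ.*-cancelˡ-≤ 2 K≤2n)))
... | odd P  =
  [ (λ F≡ → trans F≡ (cong (λ g → ½ * g - 0ℚ) (G≡0 (suc P) (ℕₚ.*-cancelˡ-< 2 P n K≤2n))))
  , (λ F≡ → trans F≡ (cong (λ g → ½ * g + 0ℚ) (G≡0 P (ℕₚ.*-cancelˡ-≤ 2 (ℕₚ.<⇒≤ K≤2n)))))
  ]′ (at-odd H P)

∣Σ<∣≤-of-paired-cancellation : ∀ {f : ℕ → ℚ} {B} → 0ℚ ≤ B → (∀ P → Σ< (2 ℕ.* P) f ≡ 0ℚ) →
                                (∀ P → ∣ f (2 ℕ.* P) ∣ ≤ B) → ∀ K → ∣ Σ< K f ∣ ≤ B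
∣Σ<∣≤-of-paired-cancellation {f} {B} 0≤B Σ<2*≡0 ∣f∣≤B K with evenOdd K
... | even P = subst (λ t → ∣ t ∣ ≤ B) (sym (Σ<2*≡0 P)) 0≤B
... | odd P  = subst (λ t → ∣ t ∣ ≤ B)
  (sym (trans (cong (_+ f (2 ℕ.* P)) (Σ<2*≡0 P)) (ℚₚ.+-identityˡ _))) (∣f∣≤B P)

Perm₂ : {A : Set} → A → A → A → A → Set
Perm₂ u v a b = (u ≡ a × v ≡ b) ⊎ (u ≡ b × v ≡ a)

module _ {A : Set} {u v a b : A} where

  Perm₂-map : {B : Set} (f : A → B) → Perm₂ u v a b → Perm₂ (f u) (f v) (f a) (f b)
  Perm₂-map f (inj₁ (u≡a , v≡b)) = inj₁ (cong f u≡a , cong f v≡b)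
  Perm₂-map f (inj₂ (u≡b , v≡a)) = inj₂ (cong f u≡b , cong f v≡a)

  Perm₂-trans : ∀ {c d} → Perm₂ u v a b → Perm₂ a b c d → Perm₂ u v c d
  Perm₂-trans (inj₁ (u≡a , v≡b)) (inj₁ (a≡c , b≡d)) = inj₁ (trans u≡a a≡c , trans v≡b b≡d)
  Perm₂-trans (inj₁ (u≡a , v≡b)) (inj₂ (a≡d , b≡c)) = inj₂ (trans u≡a a≡d , trans v≡b b≡c)
  Perm₂-trans (inj₂ (u≡b , v≡a)) (inj₁ (a≡c , b≡d)) = inj₂ (trans u≡b b≡d , trans v≡a a≡c)
  Perm₂-trans (inj₂ (u≡b , v≡a)) (inj₂ (a≡d , b≡c)) = inj₁ (trans u≡b b≡c , trans v≡a a≡d)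

  Perm₂-fst : Perm₂ u v a b → u ≡ a ⊎ u ≡ b
  Perm₂-fst (inj₁ (u≡a , _)) = inj₁ u≡a
  Perm₂-fst (inj₂ (u≡b , _)) = inj₂ u≡b

Perm₂-+ : ∀ {u v a b} → Perm₂ u v a b → u + v ≡ a + b
Perm₂-+ (inj₁ (u≡a , v≡b)) = cong₂ _+_ u≡a v≡b
Perm₂-+ {a = a} {b} (inj₂ (u≡b , v≡a)) = trans (cong₂ _+_ u≡b v≡a) (ℚₚ.+-comm b a)

segLen-empty : ∀ {x u v} → v ≤ x → segLen x u v ≡ 0ℚ
segLen-empty {x} {u} v≤x = ℚₚ.p≥q⇒p⊔q≡p (p≤q⇒p-q≤0 (ℚₚ.≤-trans v≤x (ℚₚ.p≤p⊔q x u)))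

segLen-whole : ∀ {x u v} → x ≤ u → u ≤ v → segLen x u v ≡ v - u
segLen-whole x≤u u≤v rewrite ℚₚ.p≤q⇒p⊔q≡q x≤u = ℚₚ.p≤q⇒p⊔q≡q (p≤q⇒0≤q-p u≤v)

segLen-tail : ∀ {x u v} → u ≤ x → x ≤ v → segLen x u v ≡ v - x
segLen-tail u≤x x≤v rewrite ℚₚ.p≥q⇒p⊔q≡p u≤x = ℚₚ.p≤q⇒p⊔q≡q (p≤q⇒0≤q-p x≤v)

segLen-affine : ∀ β x u v → segLen (½ * x + β) (½ * u + β) (½ * v + β) ≡ ½ * segLen x u v
segLen-affine β x u v = begin
  0ℚ ⊔ (f v - (f x ⊔ f u))     ≡⟨ cong (λ t → 0ℚ ⊔ (f v - t)) (sym (ℚₚ.mono-≤-distrib-⊔ f-mono x u)) ⟩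
  0ℚ ⊔ (f v - f (x ⊔ u))       ≡⟨ cong (0ℚ ⊔_) (difference β v (x ⊔ u)) ⟩
  ½ * 0ℚ ⊔ ½ * (v - (x ⊔ u))   ≡⟨ sym (ℚₚ.*-distribˡ-⊔-nonNeg ½ 0ℚ (v - (x ⊔ u))) ⟩
  ½ * segLen x u v             ∎
  where
  open ≡-Reasoning
  f : ℚ → ℚ
  f t = ½ * t + β
  f-mono : ∀ {p q} → p ≤ q → f p ≤ f q
  f-mono p≤q = ℚₚ.+-monoˡ-≤ β (½*-mono-≤ p≤q)
  difference : ∀ β v t → (½ * v + β) - (½ * t + β) ≡ ½ * (v - t)
  difference = solve-∀ ℚ-ring

tailIntegral : ℚ → ℚ → ℚ → ℚ
tailIntegral a h x = segLen x a (a + h) - segLen x (a + h) (a + h + h)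

module _ (a h : ℚ) {x : ℚ} where

  tailIntegral-left : 0ℚ ≤ h → x ≤ a → tailIntegral a h x ≡ 0ℚ
  tailIntegral-left 0≤h x≤a = trans
    (cong₂ _-_ (segLen-whole x≤a a≤a+h) (segLen-whole (ℚₚ.≤-trans x≤a a≤a+h) (0≤q⇒p≤p+q (a + h) 0≤h)))
    (cancel a h)
    where
    a≤a+h = 0≤q⇒p≤p+q a 0≤h
    cancel : ∀ a h → (a + h - a) - (a + h + h - (a + h)) ≡ 0ℚ
    cancel = solve-∀ ℚ-ring

  tailIntegral-right : 0ℚ ≤ h → a + h + h ≤ x → tailIntegral a h x ≡ 0ℚ
  tailIntegral-right 0≤h b≤x = cong₂ _-_
    (segLen-empty (ℚₚ.≤-trans (0≤q⇒p≤p+q (a + h) 0≤h) b≤x)) (segLen-empty b≤x)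

  tailIntegral-first-half : 0ℚ ≤ h → a ≤ x → x ≤ a + h → tailIntegral a h x ≡ a - x
  tailIntegral-first-half 0≤h a≤x x≤c = trans
    (cong₂ _-_ (segLen-tail a≤x x≤c) (segLen-whole x≤c (0≤q⇒p≤p+q (a + h) 0≤h)))
    (simplify a h x)
    where
    simplify : ∀ a h x → (a + h - x) - (a + h + h - (a + h)) ≡ a - x
    simplify = solve-∀ ℚ-ring

  tailIntegral-second-half : a + h ≤ x → x ≤ a + h + h → tailIntegral a h x ≡ x - (a + h + h)
  tailIntegral-second-half c≤x x≤b = trans
    (cong₂ _-_ (segLen-empty c≤x) (segLen-tail c≤x x≤b))
    (simplify (a + h + h) x)
    where
    simplify : ∀ b x → 0ℚ - (b - x) ≡ x - b
    simplify = solve-∀ ℚ-ring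

tailIntegral-affine : ∀ β a h x → tailIntegral (½ * a + β) (½ * h) (½ * x + β) ≡ ½ * tailIntegral a h x
tailIntegral-affine β a h x = begin
  segLen (f x) (f a) (f a + ½ * h) - segLen (f x) (f a + ½ * h) (f a + ½ * h + ½ * h)
    ≡⟨ cong₂ (λ c b → segLen (f x) (f a) c - segLen (f x) c b) (shift β a h)
         (trans (cong (_+ ½ * h) (shift β a h)) (shift β (a + h) h)) ⟩
  segLen (f x) (f a) (f (a + h)) - segLen (f x) (f (a + h)) (f (a + h + h))
    ≡⟨ cong₂ _-_ (segLen-affine β x a (a + h)) (segLen-affine β x (a + h) (a + h + h)) ⟩
  ½ * segLen x a (a + h) - ½ * segLen x (a + h) (a + h + h)
    ≡⟨ sym (*-distribˡ-- ½ (segLen x a (a + h)) (segLen x (a + h) (a + h + h))) ⟩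
  ½ * tailIntegral a h x
    ∎
  where
  open ≡-Reasoning
  f : ℚ → ℚ
  f t = ½ * t + β
  shift : ∀ β t h → (½ * t + β) + ½ * h ≡ ½ * (t + h) + β
  shift = solve-∀ ℚ-ring
  *-distribˡ-- : ∀ c p q → c * (p - q) ≡ c * p - c * q
  *-distribˡ-- = solve-∀ ℚ-ring

haarC≡ : ∀ j m → haarC j m ≡ haarA j m + inv2^ (suc j)
haarC≡ j m = trans (cong (_* (½ * inv2^ j)) (trans (ι-+ (2 ℕ.* m) 1) (cong (_+ 1ℚ) (ι-2* m))))
                   (midpoint (ι m) (inv2^ j))
  where
  midpoint : ∀ m i → (m + m + 1ℚ) * (½ * i) ≡ m * i + ½ * i
  midpoint = solve-∀ ℚ-ring

haarB≡ : ∀ j m → haarB j m ≡ haarA j m + inv2^ (suc j) + inv2^ (suc j)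
haarB≡ j m = trans (cong (_* inv2^ j) (ι-+ 1 m)) (endpoint (ι m) (inv2^ j))
  where
  endpoint : ∀ m i → (1ℚ + m) * i ≡ m * i + ½ * i + ½ * i
  endpoint = solve-∀ ℚ-ring

intIndHaar≡tailIntegral : ∀ j m x → intIndHaar j m x ≡ tailIntegral (haarA j m) (inv2^ (suc j)) x
intIndHaar≡tailIntegral j m x =
  cong₂ (λ c b → segLen x (haarA j m) c - segLen x c b) (haarC≡ j m) (haarB≡ j m)

h² : ℕ → ℚ
h² j = inv2^ (suc j) * inv2^ (suc j)

h²-nonneg : ∀ j → 0ℚ ≤ h² j
h²-nonneg j = subst (_≤ h² j) (ℚₚ.*-zeroˡ (inv2^ (suc j)))
  (ℚₚ.*-monoʳ-≤-nonNeg (inv2^ (suc j)) {{ℚ.nonNegative (inv2^-nonneg (suc j))}} (inv2^-nonneg (suc j)))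

intIdHaar≡-h² : ∀ j m → intIdHaar j m ≡ - h² j
intIdHaar≡-h² j m = trans
  (cong₂ (λ c b → ½ * (c * c - a * a) - ½ * (b * b - c * c)) (haarC≡ j m) (haarB≡ j m))
  (integral a (inv2^ (suc j)))
  where
  a = haarA j m
  integral : ∀ a h → ½ * ((a + h) * (a + h) - a * a) - ½ * ((a + h + h) * (a + h + h) - (a + h) * (a + h))
                     ≡ - (h * h)
  integral = solve-∀ ℚ-ring

haarA-nonneg : ∀ j m → 0ℚ ≤ haarA j m
haarA-nonneg j m = subst (_≤ haarA j m) (ℚₚ.*-zeroˡ (inv2^ j))
  (ℚₚ.*-monoʳ-≤-nonNeg (inv2^ j) {{ℚ.nonNegative (inv2^-nonneg j)}} (ι-nonneg m))

haarB≤1 : ∀ j m → m < 2 ^ j → haarB j m ≤ 1ℚ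
haarB≤1 j m m<2^j = subst (haarB j m ≤_) (ι[2^j]*inv2^j≡1 j)
  (ℚₚ.*-monoʳ-≤-nonNeg (inv2^ j) {{ℚ.nonNegative (inv2^-nonneg j)}} (ι-mono-≤ m<2^j))

intIndHaar-left : ∀ j m {x} → x ≤ 0ℚ → intIndHaar j m x ≡ 0ℚ
intIndHaar-left j m {x} x≤0 = trans (intIndHaar≡tailIntegral j m x)
  (tailIntegral-left (haarA j m) (inv2^ (suc j)) (inv2^-nonneg (suc j))
    (ℚₚ.≤-trans x≤0 (haarA-nonneg j m)))

intIndHaar-right : ∀ j m {x} → m < 2 ^ j → 1ℚ ≤ x → intIndHaar j m x ≡ 0ℚ
intIndHaar-right j m {x} m<2^j 1≤x = trans (intIndHaar≡tailIntegral j m x)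
  (tailIntegral-right (haarA j m) (inv2^ (suc j)) (inv2^-nonneg (suc j))
    (subst (_≤ x) (haarB≡ j m) (ℚₚ.≤-trans (haarB≤1 j m m<2^j) 1≤x)))

haarA-lower : ∀ j m → haarA (suc j) m ≡ ½ * haarA j m + 0ℚ
haarA-lower j m = rescale (ι m) (inv2^ j)
  where
  rescale : ∀ m i → m * (½ * i) ≡ ½ * (m * i) + 0ℚ
  rescale = solve-∀ ℚ-ring

haarA-upper : ∀ j m → haarA (suc j) (2 ^ j ℕ.+ m) ≡ ½ * haarA j m + ½
haarA-upper j m = begin
  ι (2 ^ j ℕ.+ m) * (½ * inv2^ j)              ≡⟨ cong (_* (½ * inv2^ j)) (ι-+ (2 ^ j) m) ⟩
  (ι (2 ^ j) + ι m) * (½ * inv2^ j)            ≡⟨ rescale (ι (2 ^ j)) (ι m) (inv2^ j) ⟩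
  ½ * haarA j m + ½ * (ι (2 ^ j) * inv2^ j)    ≡⟨ cong (λ t → ½ * haarA j m + ½ * t) (ι[2^j]*inv2^j≡1 j) ⟩
  ½ * haarA j m + ½ * 1ℚ                       ∎
  where
  open ≡-Reasoning
  rescale : ∀ p m i → (p + m) * (½ * i) ≡ ½ * (m * i) + ½ * (p * i)
  rescale = solve-∀ ℚ-ring

intIndHaar-affine : ∀ j m m′ β → haarA (suc j) m′ ≡ ½ * haarA j m + β →
                    ∀ x → intIndHaar (suc j) m′ (½ * x + β) ≡ ½ * intIndHaar j m x
intIndHaar-affine j m m′ β a′≡ x = begin
  intIndHaar (suc j) m′ (½ * x + β)
    ≡⟨ intIndHaar≡tailIntegral (suc j) m′ (½ * x + β) ⟩
  tailIntegral (haarA (suc j) m′) (½ * inv2^ (suc j)) (½ * x + β)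
    ≡⟨ cong (λ a → tailIntegral a (½ * inv2^ (suc j)) (½ * x + β)) a′≡ ⟩
  tailIntegral (½ * haarA j m + β) (½ * inv2^ (suc j)) (½ * x + β)
    ≡⟨ tailIntegral-affine β (haarA j m) (inv2^ (suc j)) x ⟩
  ½ * tailIntegral (haarA j m) (inv2^ (suc j)) x
    ≡⟨ cong (½ *_) (intIndHaar≡tailIntegral j m x) ⟨
  ½ * intIndHaar j m x
    ∎
  where open ≡-Reasoning

record Refines (e : ℚ) (G′ G : ℚ → ℚ) : Set where
  constructor refines
  field
    halves : ∀ y → 0ℚ ≤ y → y ≤ 1ℚ → Perm₂ (G′ (½ * y)) (G′ (½ * y + ½)) (½ * G y - e) e

haar-refines-lower : ∀ j m → m < 2 ^ j → Refines 0ℚ (intIndHaar (suc j) m) (intIndHaar j m)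
haar-refines-lower j m m<2^j = refines λ y 0≤y _ → inj₁ (on y , off y 0≤y)
  where
  G′ = intIndHaar (suc j) m
  on : ∀ y → G′ (½ * y) ≡ ½ * intIndHaar j m y - 0ℚ
  on y = trans (cong G′ (sym (ℚₚ.+-identityʳ (½ * y))))
               (trans (intIndHaar-affine j m m 0ℚ (haarA-lower j m) y) (sym (ℚₚ.+-identityʳ _)))
  off : ∀ y → 0ℚ ≤ y → G′ (½ * y + ½) ≡ 0ℚ
  off y 0≤y = begin
    G′ (½ * y + ½)              ≡⟨ cong G′ (shift y) ⟩
    G′ (½ * (1ℚ + y) + 0ℚ)      ≡⟨ intIndHaar-affine j m m 0ℚ (haarA-lower j m) (1ℚ + y) ⟩
    ½ * intIndHaar j m (1ℚ + y) ≡⟨ cong (½ *_) (intIndHaar-right j m m<2^j (0≤q⇒p≤p+q 1ℚ 0≤y)) ⟩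
    0ℚ                          ∎
    where
    open ≡-Reasoning
    shift : ∀ y → ½ * y + ½ ≡ ½ * (1ℚ + y) + 0ℚ
    shift = solve-∀ ℚ-ring

haar-refines-upper : ∀ j m → m < 2 ^ j → Refines 0ℚ (intIndHaar (suc j) (2 ^ j ℕ.+ m)) (intIndHaar j m)
haar-refines-upper j m m<2^j = refines λ y _ y≤1 → inj₂ (off y y≤1 , on y)
  where
  G′ = intIndHaar (suc j) (2 ^ j ℕ.+ m)
  on : ∀ y → G′ (½ * y + ½) ≡ ½ * intIndHaar j m y - 0ℚ
  on y = trans (intIndHaar-affine j m (2 ^ j ℕ.+ m) ½ (haarA-upper j m) y) (sym (ℚₚ.+-identityʳ _))
  off : ∀ y → y ≤ 1ℚ → G′ (½ * y) ≡ 0ℚ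
  off y y≤1 = begin
    G′ (½ * y)                   ≡⟨ cong G′ (shift y) ⟩
    G′ (½ * (y - 1ℚ) + ½)        ≡⟨ intIndHaar-affine j m (2 ^ j ℕ.+ m) ½ (haarA-upper j m) (y - 1ℚ) ⟩
    ½ * intIndHaar j m (y - 1ℚ)  ≡⟨ cong (½ *_) (intIndHaar-left j m (p≤q⇒p-q≤0 y≤1)) ⟩
    0ℚ                           ∎
    where
    open ≡-Reasoning
    shift : ∀ y → ½ * y ≡ ½ * (y - 1ℚ) + ½
    shift = solve-∀ ℚ-ring

haar-refines : ∀ j m → m < 2 ^ suc j →
               ∃[ m′ ] m′ < 2 ^ j × Refines 0ℚ (intIndHaar (suc j) m) (intIndHaar j m′)
haar-refines j m m<2^[1+j] with m ℕ.<? 2 ^ j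
... | yes m<2^j = m , m<2^j , haar-refines-lower j m m<2^j
... | no m≮2^j  = m ℕ.∸ 2 ^ j , m∸2^j<2^j ,
  subst (λ k → Refines 0ℚ (intIndHaar (suc j) k) (intIndHaar j (m ℕ.∸ 2 ^ j)))
        (ℕₚ.m+[n∸m]≡n (ℕₚ.≮⇒≥ m≮2^j)) (haar-refines-upper j (m ℕ.∸ 2 ^ j) m∸2^j<2^j)
  where
  m∸2^j<2^j : m ℕ.∸ 2 ^ j < 2 ^ j
  m∸2^j<2^j = ℕₚ.m<n+o⇒m∸n<o m (2 ^ j) {{ℕₚ.m^n≢0 2 j}}
    (subst (m <_) (cong (2 ^ j ℕ.+_) (ℕₚ.+-identityʳ (2 ^ j))) m<2^[1+j])

2*k%2≡0 : ∀ k → (2 ℕ.* k) ℕ.% 2 ≡ 0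
2*k%2≡0 k = trans (cong (ℕ._% 2) (ℕₚ.*-comm 2 k)) (ℕ.m*n%n≡0 k 2)

2*k/2≡k : ∀ k → (2 ℕ.* k) ℕ./ 2 ≡ k
2*k/2≡k k = trans (cong (ℕ._/ 2) (ℕₚ.*-comm 2 k)) (ℕ.m*n/n≡m k 2)

[1+2*k]%2≡1 : ∀ k → suc (2 ℕ.* k) ℕ.% 2 ≡ 1
[1+2*k]%2≡1 k = trans (cong (λ n → suc n ℕ.% 2) (ℕₚ.*-comm 2 k)) (ℕ.[m+kn]%n≡m%n 1 k 2)

[1+2*k]/2≡k : ∀ k → suc (2 ℕ.* k) ℕ./ 2 ≡ k
[1+2*k]/2≡k k = trans (cong (λ n → suc n ℕ./ 2) (ℕₚ.*-comm 2 k))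
  (trans (ℕ.+-distrib-/-∣ʳ 1 {d = 2} (divides k refl)) (ℕ.m*n/n≡m k 2))

φaux-zero : ∀ f → φaux f 0 ≡ 0ℚ
φaux-zero zero    = refl
φaux-zero (suc f) = cong (λ t → ½ * ι 0 + ½ * t) (φaux-zero f)

φaux-fuel : ∀ f g n → n ℕ.≤ f → n ℕ.≤ g → φaux f n ≡ φaux g n
φaux-fuel zero    g       zero z≤n _   = sym (φaux-zero g)
φaux-fuel (suc f) zero    zero _   z≤n = φaux-zero (suc f)
φaux-fuel (suc f) (suc g) n    n≤f n≤g =
  cong (λ t → ½ * ι (n ℕ.% 2) + ½ * t) (φaux-fuel f g (n ℕ./ 2) (half≤ n≤f) (half≤ n≤g))
  where
  half≤ : ∀ {n f} → n ℕ.≤ suc f → n ℕ./ 2 ℕ.≤ f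
  half≤ {zero}  _      = z≤n
  half≤ {suc n} n<1+f = ℕₚ.≤-pred (ℕₚ.<-≤-trans (ℕ.m/n<m (suc n) 2 (s≤s (s≤s z≤n))) n<1+f)

φ-unfold : ∀ n → φ n ≡ ½ * ι (n ℕ.% 2) + ½ * φ (n ℕ./ 2)
φ-unfold n = trans (φaux-fuel n (suc n) n ℕₚ.≤-refl (ℕₚ.n≤1+n n))
  (cong (λ t → ½ * ι (n ℕ.% 2) + ½ * t) (φaux-fuel n (n ℕ./ 2) (n ℕ./ 2) (ℕ.m/n≤m n 2) ℕₚ.≤-refl))

φ-2* : ∀ k → φ (2 ℕ.* k) ≡ ½ * φ k
φ-2* k = trans (φ-unfold (2 ℕ.* k))
  (trans (cong₂ (λ d q → ½ * ι d + ½ * φ q) (2*k%2≡0 k) (2*k/2≡k k)) (ℚₚ.+-identityˡ (½ * φ k)))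

φ-1+2* : ∀ k → φ (suc (2 ℕ.* k)) ≡ ½ * φ k + ½
φ-1+2* k = trans (φ-unfold (suc (2 ℕ.* k)))
  (trans (cong₂ (λ d q → ½ * ι d + ½ * φ q) ([1+2*k]%2≡1 k) ([1+2*k]/2≡k k)) (ℚₚ.+-comm ½ (½ * φ k)))

φaux-range : ∀ f n → 0ℚ ≤ φaux f n × φaux f n ≤ 1ℚ
φaux-range zero    n = ℚₚ.≤-refl , ℚₚ.nonNegative⁻¹ 1ℚ
φaux-range (suc f) n with φaux-range f (n ℕ./ 2)
... | 0≤φ , φ≤1 =
    ℚₚ.+-mono-≤ (½*-mono-≤ (ι-nonneg (n ℕ.% 2))) (½*-mono-≤ 0≤φ)
  , ℚₚ.+-mono-≤ (½*-mono-≤ (ι-mono-≤ (ℕₚ.≤-pred (ℕ.m%n<n n 2)))) (½*-mono-≤ φ≤1)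

reflect : (ℕ → ℚ) → ℕ → ℚ
reflect w k = 1ℚ - w k

z-2* : ∀ k → z (2 ℕ.* k) ≡ φ k
z-2* k = trans (even-index (2 ℕ.* k) (2*k%2≡0 k)) (cong φ (2*k/2≡k k))
  where
  even-index : ∀ n → n ℕ.% 2 ≡ 0 → z n ≡ φ (n ℕ./ 2)
  even-index n n%2≡0 with n ℕ.% 2
  ... | zero = refl

z-1+2* : ∀ k → z (suc (2 ℕ.* k)) ≡ reflect φ k
z-1+2* k = trans (odd-index (suc (2 ℕ.* k)) ([1+2*k]%2≡1 k)) (cong (reflect φ) ([1+2*k]/2≡k k))
  where
  odd-index : ∀ n → n ℕ.% 2 ≡ 1 → z n ≡ reflect φ (n ℕ./ 2)
  odd-index n n%2≡1 with n ℕ.% 2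
  ... | suc _ = refl

record SelfSimilar (w : ℕ → ℚ) : Set where
  field
    nonneg   : ∀ k → 0ℚ ≤ w k
    ≤1       : ∀ k → w k ≤ 1ℚ
    children : ∀ k → Perm₂ (w (2 ℕ.* k)) (w (suc (2 ℕ.* k))) (½ * w k) (½ * w k + ½)

φ-selfSimilar : SelfSimilar φ
φ-selfSimilar = record
  { nonneg   = λ k → proj₁ (φaux-range k k)
  ; ≤1       = λ k → proj₂ (φaux-range k k)
  ; children = λ k → inj₁ (φ-2* k , φ-1+2* k)
  }

reflect-selfSimilar : ∀ {w} → SelfSimilar w → SelfSimilar (reflect w)
reflect-selfSimilar {w} w-ss = record
  { nonneg   = λ k → p≤q⇒0≤q-p (≤1 k)
  ; ≤1       = λ k → subst (reflect w k ≤_) (ℚₚ.+-identityʳ 1ℚ)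
                       (ℚₚ.+-monoʳ-≤ 1ℚ (ℚₚ.neg-antimono-≤ (nonneg k)))
  ; children = λ k → Perm₂-trans (Perm₂-map (λ y → 1ℚ - y) (children k)) (inj₂ (upper (w k) , lower (w k)))
  }
  where
  open SelfSimilar w-ss
  upper : ∀ y → 1ℚ - ½ * y ≡ ½ * (1ℚ - y) + ½
  upper = solve-∀ ℚ-ring
  lower : ∀ y → 1ℚ - (½ * y + ½) ≡ ½ * (1ℚ - y)
  lower = solve-∀ ℚ-ring

Refines-shift : ∀ {G′ G c′ c} → Refines 0ℚ G′ G → c′ + c′ ≡ ½ * c →
                Refines c′ (λ x → G′ x + c′) (λ x → G x + c)
Refines-shift {G′} {G} {c′} {c} R 2c′≡½c = refines λ y 0≤y y≤1 →
  Perm₂-trans (Perm₂-map (_+ c′) (Refines.halves R y 0≤y y≤1)) (inj₁ (shifted y , ℚₚ.+-identityˡ c′))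
  where
  open ≡-Reasoning
  regroup : ∀ g c′ → ½ * g - 0ℚ + c′ ≡ ½ * g + (c′ + c′) - c′
  regroup = solve-∀ ℚ-ring
  distrib : ∀ g c c′ → ½ * g + ½ * c - c′ ≡ ½ * (g + c) - c′
  distrib = solve-∀ ℚ-ring
  shifted : ∀ y → ½ * G y - 0ℚ + c′ ≡ ½ * (G y + c) - c′
  shifted y = begin
    ½ * G y - 0ℚ + c′          ≡⟨ regroup (G y) c′ ⟩
    ½ * G y + (c′ + c′) - c′   ≡⟨ cong (λ t → ½ * G y + t - c′) 2c′≡½c ⟩
    ½ * G y + ½ * c - c′       ≡⟨ distrib (G y) c c′ ⟩
    ½ * (G y + c) - c′         ∎

-- ∫ (1_{[0,t)}(x) - t) h_{j,m}(t) dt, because intIdHaar j m = - h² j.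
μpoint : ℕ → ℕ → ℚ → ℚ
μpoint j m x = intIndHaar j m x + h² j

μpoint-refines : ∀ j m → m < 2 ^ suc j →
                 ∃[ m′ ] m′ < 2 ^ j × Refines (h² (suc j)) (μpoint (suc j) m) (μpoint j m′)
μpoint-refines j m m<2^[1+j] =
  let m′ , m′<2^j , R = haar-refines j m m<2^[1+j]
  in m′ , m′<2^j , Refines-shift R (quarter (inv2^ (suc j)))
  where
  quarter : ∀ i → (½ * i) * (½ * i) + (½ * i) * (½ * i) ≡ ½ * (i * i)
  quarter = solve-∀ ℚ-ring

coeffBound : ℕ → ℚ
coeffBound j = inv2^ (suc j) - h² j

coeffBound-suc : ∀ j → ½ * coeffBound j + ∣ h² (suc j) ∣ ≡ coeffBound (suc j)
coeffBound-suc j = trans (cong (λ t → ½ * coeffBound j + t) (ℚₚ.0≤p⇒∣p∣≡p (h²-nonneg (suc j))))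
                         (recursion (inv2^ (suc j)))
  where
  recursion : ∀ i → ½ * (i - i * i) + (½ * i) * (½ * i) ≡ ½ * i - (½ * i) * (½ * i)
  recursion = solve-∀ ℚ-ring

coeffBound+coeffBound≤ : ∀ j → coeffBound j + coeffBound j ≤ ι 2 * inv2^ j
coeffBound+coeffBound≤ j = subst (coeffBound j + coeffBound j ≤_) (complete (inv2^ j))
  (0≤q⇒p≤p+q (coeffBound j + coeffBound j)
    (ℚₚ.+-mono-≤ (ℚₚ.+-mono-≤ (inv2^-nonneg j) (h²-nonneg j)) (h²-nonneg j)))
  where
  complete : ∀ i → (½ * i - (½ * i) * (½ * i)) + (½ * i - (½ * i) * (½ * i))
                   + (i + (½ * i) * (½ * i) + (½ * i) * (½ * i)) ≡ ι 2 * i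
  complete = solve-∀ ℚ-ring

μpoint₀₀-lower : ∀ y → 0ℚ ≤ y → y ≤ 1ℚ → μpoint 0 0 (½ * y) ≡ ½ * ½ - ½ * y
μpoint₀₀-lower y 0≤y y≤1 = trans
  (cong (_+ h² 0) (trans (intIndHaar≡tailIntegral 0 0 (½ * y))
    (tailIntegral-first-half (haarA 0 0) (inv2^ 1) (ℚₚ.nonNegative⁻¹ ½) (½*-mono-≤ 0≤y) (½*-mono-≤ y≤1))))
  (reorder (½ * y))
  where
  reorder : ∀ t → (0ℚ - t) + ½ * ½ ≡ ½ * ½ - t
  reorder = solve-∀ ℚ-ring

μpoint₀₀-upper : ∀ y → 0ℚ ≤ y → y ≤ 1ℚ → μpoint 0 0 (½ * y + ½) ≡ - (½ * ½ - ½ * y)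
μpoint₀₀-upper y 0≤y y≤1 = trans
  (cong (_+ h² 0) (trans (intIndHaar≡tailIntegral 0 0 (½ * y + ½))
    (tailIntegral-second-half (haarA 0 0) (inv2^ 1)
      (ℚₚ.+-monoˡ-≤ ½ (½*-mono-≤ 0≤y)) (ℚₚ.+-monoˡ-≤ ½ (½*-mono-≤ y≤1)))))
  (reorder (½ * y))
  where
  reorder : ∀ t → (t + ½ - 1ℚ) + ½ * ½ ≡ - (½ * ½ - t)
  reorder = solve-∀ ℚ-ring

∣½*½-½*y∣≤coeffBound₀ : ∀ {y} → 0ℚ ≤ y → y ≤ 1ℚ → ∣ ½ * ½ - ½ * y ∣ ≤ coeffBound 0
∣½*½-½*y∣≤coeffBound₀ 0≤y y≤1 =
  -q≤p≤q⇒∣p∣≤q (ℚₚ.+-monoʳ-≤ (½ * ½) (ℚₚ.neg-antimono-≤ (½*-mono-≤ y≤1)))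
               (ℚₚ.+-monoʳ-≤ (½ * ½) (ℚₚ.neg-antimono-≤ (½*-mono-≤ 0≤y)))

x≡½*x+c⇒x≡c+c : ∀ {x c} → x ≡ ½ * x + c → x ≡ c + c
x≡½*x+c⇒x≡c+c {x} {c} x≡ = begin
  x                              ≡⟨ double x ⟩
  x + x - x                      ≡⟨ cong (λ t → t + t - x) x≡ ⟩
  (½ * x + c) + (½ * x + c) - x  ≡⟨ cancel x c ⟩
  c + c                          ∎
  where
  open ≡-Reasoning
  double : ∀ x → x ≡ x + x - x
  double = solve-∀ ℚ-ring
  cancel : ∀ x c → (½ * x + c) + (½ * x + c) - x ≡ c + c
  cancel = solve-∀ ℚ-ring

module _ {w : ℕ → ℚ} (w-ss : SelfSimilar w) where
  open SelfSimilar w-ss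

  refine-children : ∀ {e G′ G} → Refines e G′ G → ∀ k →
                    Perm₂ (G′ (w (2 ℕ.* k))) (G′ (w (suc (2 ℕ.* k)))) (½ * G (w k) - e) e
  refine-children {G′ = G′} R k =
    Perm₂-trans (Perm₂-map G′ (children k)) (Refines.halves R (w k) (nonneg k) (≤1 k))

  Σ<-refines : ∀ {e G′ G} → Refines e G′ G →
               HalvingRecurrence (λ K → Σ< K (G′ ∘ w)) (λ K → Σ< K (G ∘ w)) e
  Σ<-refines {e} {G′} {G} R = record { at-even = sums-even ; at-odd = sums-odd }
    where
    cancel : ∀ g e → ½ * g - e + e ≡ ½ * g
    cancel = solve-∀ ℚ-ring
    regroup : ∀ s g e → ½ * s + (½ * g - e) ≡ ½ * (s + g) - e
    regroup = solve-∀ ℚ-ring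
    sums-even : ∀ P → Σ< (2 ℕ.* P) (G′ ∘ w) ≡ ½ * Σ< P (G ∘ w)
    sums-even P = trans (Σ<-2* P (G′ ∘ w)) (trans (Σ<-cong P pair) (Σ<-*ˡ P ½ (G ∘ w)))
      where
      pair : ∀ k → G′ (w (2 ℕ.* k)) + G′ (w (suc (2 ℕ.* k))) ≡ ½ * G (w k)
      pair k = trans (Perm₂-+ (refine-children R k)) (cancel (G (w k)) e)
    sums-odd : ∀ P → Σ< (suc (2 ℕ.* P)) (G′ ∘ w) ≡ ½ * Σ< (suc P) (G ∘ w) - e
                   ⊎ Σ< (suc (2 ℕ.* P)) (G′ ∘ w) ≡ ½ * Σ< P (G ∘ w) + e
    sums-odd P with Perm₂-fst (refine-children R P)
    ... | inj₁ last≡ = inj₁ (trans (cong₂ _+_ (sums-even P) last≡) (regroup (Σ< P (G ∘ w)) (G (w P)) e))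
    ... | inj₂ last≡ = inj₂ (cong₂ _+_ (sums-even P) last≡)

  w0≡0∨w0≡1 : w 0 ≡ 0ℚ ⊎ w 0 ≡ 1ℚ
  w0≡0∨w0≡1 with Perm₂-fst (children 0)
  ... | inj₁ w0≡½w0   = inj₁ (x≡½*x+c⇒x≡c+c (trans w0≡½w0 (sym (ℚₚ.+-identityʳ (½ * w 0)))))
  ... | inj₂ w0≡½w0+½ = inj₂ (x≡½*x+c⇒x≡c+c w0≡½w0+½)

  Σ<-intIndHaar≡0 : ∀ j m → m < 2 ^ j → ∀ K → K ℕ.≤ 2 ^ j → Σ< K (intIndHaar j m ∘ w) ≡ 0ℚ
  Σ<-intIndHaar≡0 zero    zero    _ zero          _        = refl
  Σ<-intIndHaar≡0 zero    zero    _ (suc zero)    _        =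
    -- intIndHaar 0 0 vanishes at 0 and at 1 by evaluation.
    [ cong (λ x → 0ℚ + intIndHaar 0 0 x) , cong (λ x → 0ℚ + intIndHaar 0 0 x) ]′ w0≡0∨w0≡1
  Σ<-intIndHaar≡0 zero    zero    _ (suc (suc K)) (s≤s ())
  Σ<-intIndHaar≡0 zero    (suc m) (s≤s ())
  Σ<-intIndHaar≡0 (suc j) m m<2^[1+j] =
    let m′ , m′<2^j , R = haar-refines j m m<2^[1+j]
    in HalvingRecurrence-≡0 (Σ<-refines R) (2 ^ j) (Σ<-intIndHaar≡0 j m′ m′<2^j)

  μpoint₀₀-children : ∀ k → Perm₂ (μpoint 0 0 (w (2 ℕ.* k))) (μpoint 0 0 (w (suc (2 ℕ.* k))))
                                   (½ * ½ - ½ * w k) (- (½ * ½ - ½ * w k))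
  μpoint₀₀-children k = Perm₂-trans (Perm₂-map (μpoint 0 0) (children k))
    (inj₁ (μpoint₀₀-lower (w k) (nonneg k) (≤1 k) , μpoint₀₀-upper (w k) (nonneg k) (≤1 k)))

  Σ<μpoint₀₀-2*≡0 : ∀ P → Σ< (2 ℕ.* P) (μpoint 0 0 ∘ w) ≡ 0ℚ
  Σ<μpoint₀₀-2*≡0 P = begin
    Σ< (2 ℕ.* P) (μpoint 0 0 ∘ w)  ≡⟨ Σ<-2* P (μpoint 0 0 ∘ w) ⟩
    Σ< P (λ k → μpoint 0 0 (w (2 ℕ.* k)) + μpoint 0 0 (w (suc (2 ℕ.* k))))
      ≡⟨ Σ<-cong P (λ k → trans (Perm₂-+ (μpoint₀₀-children k)) (ℚₚ.+-inverseʳ (½ * ½ - ½ * w k))) ⟩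
    Σ< P (λ _ → 0ℚ)                ≡⟨ Σ<-const P 0ℚ ⟩
    ι P * 0ℚ                       ≡⟨ ℚₚ.*-zeroʳ (ι P) ⟩
    0ℚ                             ∎
    where open ≡-Reasoning

  ∣Σ<μpoint∣≤coeffBound : ∀ j m → m < 2 ^ j → ∀ K → ∣ Σ< K (μpoint j m ∘ w) ∣ ≤ coeffBound j
  ∣Σ<μpoint∣≤coeffBound zero zero _ =
    ∣Σ<∣≤-of-paired-cancellation (ℚₚ.nonNegative⁻¹ (coeffBound 0)) Σ<μpoint₀₀-2*≡0
      (λ k → ∣±p∣≤q (Perm₂-fst (μpoint₀₀-children k)) (∣½*½-½*y∣≤coeffBound₀ (nonneg k) (≤1 k)))
  ∣Σ<μpoint∣≤coeffBound zero (suc m) (s≤s ())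
  ∣Σ<μpoint∣≤coeffBound (suc j) m m<2^[1+j] K =
    let m′ , m′<2^j , R = μpoint-refines j m m<2^[1+j]
    in subst (∣ Σ< K (μpoint (suc j) m ∘ w) ∣ ≤_) (coeffBound-suc j)
             (HalvingRecurrence-∣∣≤ (Σ<-refines R) (∣Σ<μpoint∣≤coeffBound j m′ m′<2^j) K)

Σ<-z-split : ∀ N → ∃₂ λ K₁ K₂ → K₁ ℕ.+ K₂ ≡ N ×
  ∀ (g : ℚ → ℚ) → Σ< N (g ∘ z) ≡ Σ< K₁ (g ∘ φ) + Σ< K₂ (g ∘ reflect φ)
Σ<-z-split N =
  let K₁ , K₂ , K₁+K₂≡N , split = Σ<-evens-odds N
  in K₁ , K₂ , K₁+K₂≡N , λ g → trans (split (g ∘ z))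
       (cong₂ _+_ (Σ<-cong K₁ (cong g ∘ z-2*)) (Σ<-cong K₂ (cong g ∘ z-1+2*)))

μsym≡mean-μpoint : ∀ N .{{_ : NonZero N}} j m → μsym N j m ≡ (+ 1 ÷ℤ N) * Σ< N (μpoint j m ∘ z)
μsym≡mean-μpoint N j m = begin
  r * S - intIdHaar j m       ≡⟨ cong (λ t → r * S - t) (intIdHaar≡-h² j m) ⟩
  r * S - - q                 ≡⟨ unit r S q ⟩
  r * S + 1ℚ * q              ≡⟨ cong (λ t → r * S + t * q) (sym (1/N*ιN≡1 N)) ⟩
  r * S + (r * ι N) * q       ≡⟨ factor r S (ι N) q ⟩
  r * (S + ι N * q)           ≡⟨ cong (λ t → r * (S + t)) (sym (Σ<-const N q)) ⟩
  r * (S + Σ< N (λ _ → q))    ≡⟨ cong (r *_) (sym (Σ<-+ N (intIndHaar j m ∘ z) (λ _ → q))) ⟩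
  r * Σ< N (μpoint j m ∘ z)   ∎
  where
  open ≡-Reasoning
  r = + 1 ÷ℤ N
  S = Σ< N (intIndHaar j m ∘ z)
  q = h² j
  unit : ∀ r s q → r * s - - q ≡ r * s + 1ℚ * q
  unit = solve-∀ ℚ-ring
  factor : ∀ r s n q → r * s + (r * n) * q ≡ r * (s + n * q)
  factor = solve-∀ ℚ-ring

∣μsym∣≤ : ∀ N .{{_ : NonZero N}} j m → m < 2 ^ j → ∣ μsym N j m ∣ ≤ (ι 2 * inv2^ j) * (+ 1 ÷ℤ N)
∣μsym∣≤ N j m m<2^j with Σ<-z-split N
... | K₁ , K₂ , _ , split = begin
  ∣ μsym N j m ∣
    ≡⟨ cong ∣_∣ (trans (μsym≡mean-μpoint N j m) (cong (r *_) (split (μpoint j m)))) ⟩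
  ∣ r * (S₁ + S₂) ∣         ≡⟨ ℚₚ.∣p*q∣≡∣p∣*∣q∣ r (S₁ + S₂) ⟩
  ∣ r ∣ * ∣ S₁ + S₂ ∣       ≡⟨ cong (_* ∣ S₁ + S₂ ∣) (ℚₚ.0≤p⇒∣p∣≡p 0≤r) ⟩
  r * ∣ S₁ + S₂ ∣           ≤⟨ ℚₚ.*-monoˡ-≤-nonNeg r {{ℚₚ.normalize-nonNeg 1 N}} ∣S₁+S₂∣≤ ⟩
  r * (ι 2 * inv2^ j)       ≡⟨ ℚₚ.*-comm r (ι 2 * inv2^ j) ⟩
  (ι 2 * inv2^ j) * r       ∎
  where
  open ℚₚ.≤-Reasoning
  r = + 1 ÷ℤ N
  0≤r : 0ℚ ≤ r
  0≤r = ℚₚ.nonNegative⁻¹ r {{ℚₚ.normalize-nonNeg 1 N}}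
  S₁ = Σ< K₁ (μpoint j m ∘ φ)
  S₂ = Σ< K₂ (μpoint j m ∘ reflect φ)
  ∣S₁+S₂∣≤ : ∣ S₁ + S₂ ∣ ≤ ι 2 * inv2^ j
  ∣S₁+S₂∣≤ = ℚₚ.≤-trans (ℚₚ.∣p+q∣≤∣p∣+∣q∣ S₁ S₂) (ℚₚ.≤-trans
    (ℚₚ.+-mono-≤ (∣Σ<μpoint∣≤coeffBound φ-selfSimilar j m m<2^j K₁)
                 (∣Σ<μpoint∣≤coeffBound (reflect-selfSimilar φ-selfSimilar) j m m<2^j K₂))
    (coeffBound+coeffBound≤ j))

μsym≡h² : ∀ N .{{_ : NonZero N}} j m → m < 2 ^ j → N ℕ.≤ 2 ^ j → μsym N j m ≡ h² j
μsym≡h² N j m m<2^j N≤2^j with Σ<-z-split N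
... | K₁ , K₂ , K₁+K₂≡N , split = begin
  r * Σ< N (intIndHaar j m ∘ z) - intIdHaar j m
    ≡⟨ cong₂ (λ s t → r * s - t) (split (intIndHaar j m)) (intIdHaar≡-h² j m) ⟩
  r * (Σ< K₁ (intIndHaar j m ∘ φ) + Σ< K₂ (intIndHaar j m ∘ reflect φ)) - - h² j
    ≡⟨ cong₂ (λ a b → r * (a + b) - - h² j)
         (Σ<-intIndHaar≡0 φ-selfSimilar j m m<2^j K₁
           (ℕₚ.≤-trans (ℕₚ.m≤m+n K₁ K₂) K₁+K₂≤2^j))
         (Σ<-intIndHaar≡0 (reflect-selfSimilar φ-selfSimilar) j m m<2^j K₂
           (ℕₚ.≤-trans (ℕₚ.m≤n+m K₂ K₁) K₁+K₂≤2^j)) ⟩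
  r * (0ℚ + 0ℚ) - - h² j
    ≡⟨ vanish r (h² j) ⟩
  h² j
    ∎
  where
  open ≡-Reasoning
  r = + 1 ÷ℤ N
  K₁+K₂≤2^j : K₁ ℕ.+ K₂ ℕ.≤ 2 ^ j
  K₁+K₂≤2^j = subst (ℕ._≤ 2 ^ j) (sym K₁+K₂≡N) N≤2^j
  vanish : ∀ r q → r * (0ℚ + 0ℚ) - - q ≡ q
  vanish = solve-∀ ℚ-ring

⌈log₂n⌉≤j⇒n≤2^j : ∀ n j → ⌈log₂ n ⌉ ℕ.≤ j → n ℕ.≤ 2 ^ j
⌈log₂n⌉≤j⇒n≤2^j zero          j       _ = z≤n
⌈log₂n⌉≤j⇒n≤2^j (suc zero)    j       _ = ℕₚ.m^n>0 2 j
⌈log₂n⌉≤j⇒n≤2^j (suc (suc k)) zero    ⌈log₂n⌉≤0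
  with ℕₚ.≤-trans (⌈log₂⌉-mono-≤ {2} {suc (suc k)} (s≤s (s≤s z≤n))) ⌈log₂n⌉≤0
... | ()
⌈log₂n⌉≤j⇒n≤2^j n@(suc (suc k)) (suc j) ⌈log₂n⌉≤1+j = begin
  n                       ≡⟨ ℕₚ.⌊n/2⌋+⌈n/2⌉≡n n ⟨
  ℕ.⌊ n /2⌋ ℕ.+ ℕ.⌈ n /2⌉  ≤⟨ ℕₚ.+-monoˡ-≤ ℕ.⌈ n /2⌉ (ℕₚ.⌊n/2⌋≤⌈n/2⌉ n) ⟩
  ℕ.⌈ n /2⌉ ℕ.+ ℕ.⌈ n /2⌉  ≤⟨ ℕₚ.+-mono-≤ ⌈n/2⌉≤2^j ⌈n/2⌉≤2^j ⟩
  2 ^ j ℕ.+ 2 ^ j         ≡⟨ cong (2 ^ j ℕ.+_) (ℕₚ.+-identityʳ (2 ^ j)) ⟨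
  2 ^ suc j               ∎
  where
  open ℕₚ.≤-Reasoning
  ⌈n/2⌉≤2^j : ℕ.⌈ n /2⌉ ℕ.≤ 2 ^ j
  ⌈n/2⌉≤2^j = ⌈log₂n⌉≤j⇒n≤2^j ℕ.⌈ n /2⌉ j
    (subst (ℕ._≤ j) (sym (⌈log₂⌈n/2⌉⌉≡⌈log₂n⌉∸1 n)) (ℕₚ.∸-monoˡ-≤ {⌈log₂ n ⌉} {suc j} 1 ⌈log₂n⌉≤1+j))

h²≡inv2^ : ∀ j → h² j ≡ inv2^ (2 ℕ.* j ℕ.+ 2)
h²≡inv2^ j = trans (sym (inv2^-+ (suc j) (suc j))) (cong inv2^ (exponent j))
  where
  exponent : ∀ j → suc j ℕ.+ suc j ≡ 2 ℕ.* j ℕ.+ 2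
  exponent = ℕ-Solver.solve-∀

corollary2 : (N : ℕ) → .{{_ : NonZero N}} → (j m : ℕ) → m < 2 ^ j →
    ((j < ⌈log₂ N ⌉) → ∣ μsym N j m ∣ ≤ (ι 2 * inv2^ j) * (+ 1 ÷ℤ N))
    × ((j ≥ ⌈log₂ N ⌉) → ∣ μsym N j m ∣ ≡ inv2^ (2 ℕ.* j ℕ.+ 2))
corollary2 N j m m<2^j =
  -- The bound holds for every j.
  (λ _ → ∣μsym∣≤ N j m m<2^j) , exact
  where
  open ≡-Reasoning
  exact : j ≥ ⌈log₂ N ⌉ → ∣ μsym N j m ∣ ≡ inv2^ (2 ℕ.* j ℕ.+ 2)
  exact j≥⌈log₂N⌉ = begin
    ∣ μsym N j m ∣          ≡⟨ cong ∣_∣ (μsym≡h² N j m m<2^j (⌈log₂n⌉≤j⇒n≤2^j N j j≥⌈log₂N⌉)) ⟩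
    ∣ h² j ∣                ≡⟨ ℚₚ.0≤p⇒∣p∣≡p (h²-nonneg j) ⟩
    h² j                    ≡⟨ h²≡inv2^ j ⟩
    inv2^ (2 ℕ.* j ℕ.+ 2)   ∎
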